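{- Let $uv$ be an edge of a tree $T$. For $k\ge 1$, let $T^{(k)}_{uv}$ denote the tree obtained from $T$ by replacing the edge $uv$ by a path from $u$ to $v$ of length $k+1$ whose $k$ internal vertices are new, and write $T_{uv}=T^{(1)}_{uv}$. Then $diss(T_{uv})\in\{diss(T),\,diss(T)+1\}$, $diss(T^{(2)}_{uv})\in\{diss(T)+1,\,diss(T)+2\}$, and $diss(T^{(3)}_{uv})=diss(T)+2$.
   Context: A set $S$ of vertices of a graph $G$ is a dissociation set if the induced subgraph $G[S]$ has maximum degree at most $1$; $diss(G)$ is the maximum cardinality of a dissociation set of $G$. -}

module Defs where

open import Data.Nat using (ℕ; zero; suc; _+_; _≤_)
open import Data.Fin using (Fin; zero; suc; toℕ; inject₁; fromℕ; splitAt)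
open import Data.Fin.Subset using (Subset; _∈_; ∣_∣)
open import Data.Sum using (_⊎_; inj₁; inj₂)
open import Data.Product using (Σ; _×_; ∃; _,_)
open import Data.Nat.Properties using (1+n≢n)
open import Function.Definitions using (Injective)
open import Relation.Binary.PropositionalEquality using (_≡_)
open import Relation.Nullary using (¬_)
open import Level using (0ℓ)

record Graph (n : ℕ) : Set₁ where
  field
    Adj     : Fin n → Fin n → Set
    sym     : ∀ {x y} → Adj x y → Adj y x
    irrefl  : ∀ {x} → ¬ Adj x x
open Graph public

data Walk {n : ℕ} (G : Graph n) : Fin n → Fin n → Set where
  []  : ∀ {x} → Walk G x x
  _∷_ : ∀ {x y z} → Adj G x y → Walk G y z → Walk G x z

Connected : ∀ {n} → Graph n → Set
Connected G = ∀ x y → Walk G x y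

-- A cycle of length m + 3: distinct vertices c₀,…,c_{m+2} with
-- consecutive ones adjacent and c_{m+2} adjacent to c₀.
HasCycle : ∀ {n} → Graph n → Set
HasCycle {n} G =
  Σ ℕ λ m → Σ (Fin (3 + m) → Fin n) λ c →
    Injective _≡_ _≡_ c
    × (∀ (i : Fin (2 + m)) → Adj G (c (inject₁ i)) (c (suc i)))
    × Adj G (c (fromℕ (2 + m))) (c zero)

IsTree : ∀ {n} → Graph n → Set
IsTree G = Connected G × ¬ HasCycle G

-- Dissociation set: the induced subgraph G[S] has maximum degree ≤ 1,
-- i.e. no vertex of S has two distinct neighbours in S.
IsDissociationSet : ∀ {n} → Graph n → Subset n → Set
IsDissociationSet G S =
  ∀ {x y z} → x ∈ S → y ∈ S → z ∈ S → Adj G x y → Adj G x z → y ≡ z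

IsDiss : ∀ {n} → Graph n → ℕ → Set
IsDiss G d =
  (Σ _ λ S → IsDissociationSet G S × ∣ S ∣ ≡ d)
  × (∀ S → IsDissociationSet G S → ∣ S ∣ ≤ d)

-- Subdivision T^{(k)}_{uv}: vertices Fin (n + k); the old vertex x is
-- inject+ k x, the new internal vertex p_i (i : Fin k) is raise n i.
-- The edge uv is removed and replaced by the path u p₀ p₁ … p_{k-1} v.
module _ {n : ℕ} (G : Graph n) (u v : Fin n) (k : ℕ) where
  private
    OldAdj : Fin n → Fin n → Set
    OldAdj x y = Adj G x y × ¬ (x ≡ u × y ≡ v) × ¬ (x ≡ v × y ≡ u)

    OldNew : Fin n → Fin k → Set
    OldNew x i = (x ≡ u × toℕ i ≡ 0) ⊎ (x ≡ v × suc (toℕ i) ≡ k)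

    NewNew : Fin k → Fin k → Set
    NewNew i j = suc (toℕ i) ≡ toℕ j ⊎ suc (toℕ j) ≡ toℕ i

    A : Fin n ⊎ Fin k → Fin n ⊎ Fin k → Set
    A (inj₁ x) (inj₁ y) = OldAdj x y
    A (inj₁ x) (inj₂ j) = OldNew x j
    A (inj₂ i) (inj₁ y) = OldNew y i
    A (inj₂ i) (inj₂ j) = NewNew i j

    A-sym : ∀ {a b} → A a b → A b a
    A-sym {inj₁ x} {inj₁ y} (e , p , q) =
      sym G e , (λ { (r , s) → q (s , r) }) , (λ { (r , s) → p (s , r) })
    A-sym {inj₁ x} {inj₂ j} h = h
    A-sym {inj₂ i} {inj₁ y} h = h
    A-sym {inj₂ i} {inj₂ j} (inj₁ h) = inj₂ h
    A-sym {inj₂ i} {inj₂ j} (inj₂ h) = inj₁ h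

    A-irrefl : ∀ {a} → ¬ A a a
    A-irrefl {inj₁ x} (e , _ , _) = irrefl G e
    A-irrefl {inj₂ i} (inj₁ h) = 1+n≢n h
    A-irrefl {inj₂ i} (inj₂ h) = 1+n≢n h

  SubdivAdj : Fin (n + k) → Fin (n + k) → Set
  SubdivAdj x y = A (splitAt n x) (splitAt n y)

  subdivide : Graph (n + k)
  subdivide = record
    { Adj    = SubdivAdj
    ; sym    = A-sym
    ; irrefl = A-irrefl
    }

{-# OPTIONS --safe #-}
-- A dissociation set of T^{(k)}_{uv} is a pair (S, P) of old vertices and path vertices p₀ … p_{k-1}.
-- Lower bounds: a dissociation set S of T extends by 0, 1, 2 path vertices for k = 1, 2, 3;
-- if u, v ∈ S then v is the only S-neighbour of u (and vice versa), so u and v can each be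
-- matched with their path neighbour once the edge uv is gone.
-- Upper bounds: S stays a dissociation set of T unless u, v ∈ S; then dropping u costs one vertex,
-- which the short path compensates, except for k = 3 and P = {p₀, p₂}, where u and v already
-- have a neighbour on the path, so S itself is a dissociation set of T.
module Submission where

open import Defs hiding (sym)
open import Data.Nat using (ℕ; suc; _+_; _≤_; z≤n; s≤s; s≤s⁻¹)
open import Data.Nat.Properties
  using (≤-refl; ≤-trans; ≤-antisym; n≤1+n; +-suc; +-assoc; +-identityʳ; +-comm; +-monoˡ-≤; +-monoʳ-≤;
         m≤n⇒m<n∨m≡n; ≤∧≢⇒<; module ≤-Reasoning)
open import Data.Fin using (Fin; zero; suc; toℕ; splitAt; join; _≟_)
open import Data.Fin.Properties using (splitAt-join; join-splitAt)
open import Data.Fin.Subset using (Subset; outside; inside; _∈_; _∉_; ∣_∣; ⊤; ⁅_⁆; _─_; _-_)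
open import Data.Fin.Subset.Properties
  using (_∈?_; ∣p∣≤n; ∣p∣≡n⇒p≡⊤; ∣⁅x⁆∣≡1; p─q⊆p; x∈p∧x≢y⇒x∈p-y; x∉⁅y⁆⇒x≢y)
open import Data.Vec using (_∷_; []; _++_; here; there)
import Data.Vec as Vec
open import Data.Vec.Properties using (lookup-splitAt; lookup⇒[]=; []=⇒lookup)
open import Data.Sum using (_⊎_; inj₁; inj₂; [_,_]′; map₂)
open import Data.Sum.Properties using (inj₁-injective)
open import Data.Product using (Σ; _×_; _,_; proj₁; proj₂)
open import Data.Empty using (⊥)
open import Function using (id; _∘_)
open import Function.Definitions using (Injective)
open import Level using (0ℓ)
open import Relation.Binary.Definitions using (Symmetric)
open import Relation.Binary.PropositionalEquality
  using (_≡_; _≢_; refl; sym; trans; cong; subst; subst₂)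
open import Relation.Nullary using (¬_; yes; no; contradiction)
open import Relation.Nullary.Decidable using (decidable-stable; _×-dec_)
open import Relation.Unary using (Pred; _⊆_; _⊆′_; _∪_; ｛_｝)

module _ {V : Set} (_~_ : V → V → Set) where

  Dissociated : Pred V 0ℓ → Set
  Dissociated I = ∀ {a b c} → I a → I b → I c → a ~ b → a ~ c → b ≡ c

  Separated : Pred V 0ℓ → Pred V 0ℓ → Set
  Separated I J = ∀ {a b} → I a → J b → ¬ a ~ b

  dissociated-⊆′ : ∀ {I J : Pred V 0ℓ} → I ⊆′ J → Dissociated J → Dissociated I
  dissociated-⊆′ I⊆J D ia ib ic = D (I⊆J _ ia) (I⊆J _ ib) (I⊆J _ ic)

  dissociated-｛｝ : (x : V) → Dissociated ｛ x ｝
  dissociated-｛｝ x refl refl refl _ _ = refl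

  dissociated-pair : (∀ {a} → ¬ a ~ a) → (x y : V) → Dissociated (｛ x ｝ ∪ ｛ y ｝)
  dissociated-pair irr x y (inj₁ refl) (inj₁ refl) _           ab _  = contradiction ab irr
  dissociated-pair irr x y (inj₁ refl) _           (inj₁ refl) _  ac = contradiction ac irr
  dissociated-pair irr x y (inj₂ refl) (inj₂ refl) _           ab _  = contradiction ab irr
  dissociated-pair irr x y (inj₂ refl) _           (inj₂ refl) _  ac = contradiction ac irr
  dissociated-pair irr x y _           (inj₁ refl) (inj₁ refl) _  _  = refl
  dissociated-pair irr x y _           (inj₂ refl) (inj₂ refl) _  _  = refl

  dissociated-∪ : ∀ {I J : Pred V 0ℓ} → Symmetric _~_ →
    Dissociated I → Dissociated J → Separated I J → Dissociated (I ∪ J)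
  dissociated-∪ ~-sym DI DJ sep (inj₁ ia) (inj₁ ib) (inj₁ ic) ab ac = DI ia ib ic ab ac
  dissociated-∪ ~-sym DI DJ sep (inj₁ ia) (inj₁ ib) (inj₂ jc) ab ac = contradiction ac (sep ia jc)
  dissociated-∪ ~-sym DI DJ sep (inj₁ ia) (inj₂ jb) _         ab ac = contradiction ab (sep ia jb)
  dissociated-∪ ~-sym DI DJ sep (inj₂ ja) (inj₁ ib) _         ab ac = contradiction (~-sym ab) (sep ib ja)
  dissociated-∪ ~-sym DI DJ sep (inj₂ ja) (inj₂ jb) (inj₁ ic) ab ac = contradiction (~-sym ac) (sep ic ja)
  dissociated-∪ ~-sym DI DJ sep (inj₂ ja) (inj₂ jb) (inj₂ jc) ab ac = DJ ja jb jc ab ac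

dissociated-pullback : ∀ {V W : Set} {_~_ : V → V → Set} {_≈_ : W → W → Set}
  {I : Pred V 0ℓ} {J : Pred W 0ℓ} (f : V → W) → Injective _≡_ _≡_ f →
  (∀ {a b} → I a → I b → a ~ b → f a ≈ f b) → (∀ {a} → I a → J (f a)) →
  Dissociated _≈_ J → Dissociated _~_ I
dissociated-pullback f f-inj hom mem D ia ib ic ab ac =
  f-inj (D (mem ia) (mem ib) (mem ic) (hom ia ib ab) (hom ia ic ac))

x∈p─q⇒x∉q : ∀ {n} {x : Fin n} {p q : Subset n} → x ∈ p ─ q → x ∉ q
x∈p─q⇒x∉q {p = _ ∷ _} {inside ∷ _} () here
x∈p─q⇒x∉q {p = _ ∷ _} {_ ∷ _} (there x∈p─q) (there x∈q) = x∈p─q⇒x∉q x∈p─q x∈q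

x∈p-y⇒x≢y : ∀ {n} {x y : Fin n} {p : Subset n} → x ∈ p - y → x ≢ y
x∈p-y⇒x≢y = x∉⁅y⁆⇒x≢y ∘ x∈p─q⇒x∉q

∣p∣≤∣p─q∣+∣q∣ : ∀ {n} (p q : Subset n) → ∣ p ∣ ≤ ∣ p ─ q ∣ + ∣ q ∣
∣p∣≤∣p─q∣+∣q∣ []            []            = z≤n
∣p∣≤∣p─q∣+∣q∣ (outside ∷ p) (outside ∷ q) = ∣p∣≤∣p─q∣+∣q∣ p q
∣p∣≤∣p─q∣+∣q∣ (inside  ∷ p) (outside ∷ q) = s≤s (∣p∣≤∣p─q∣+∣q∣ p q)
∣p∣≤∣p─q∣+∣q∣ (outside ∷ p) (inside  ∷ q) =
  ≤-trans (∣p∣≤∣p─q∣+∣q∣ p q) (+-monoʳ-≤ ∣ p ─ q ∣ (n≤1+n ∣ q ∣))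
∣p∣≤∣p─q∣+∣q∣ (inside  ∷ p) (inside  ∷ q) =
  subst (suc ∣ p ∣ ≤_) (sym (+-suc ∣ p ─ q ∣ ∣ q ∣)) (s≤s (∣p∣≤∣p─q∣+∣q∣ p q))

∣p∣≤∣p-x∣+1 : ∀ {n} (p : Subset n) (x : Fin n) → ∣ p ∣ ≤ ∣ p - x ∣ + 1
∣p∣≤∣p-x∣+1 p x = subst (λ m → ∣ p ∣ ≤ ∣ p - x ∣ + m) (∣⁅x⁆∣≡1 x) (∣p∣≤∣p─q∣+∣q∣ p ⁅ x ⁆)

∣p++q∣≡∣p∣+∣q∣ : ∀ {m n} (p : Subset m) (q : Subset n) → ∣ p ++ q ∣ ≡ ∣ p ∣ + ∣ q ∣
∣p++q∣≡∣p∣+∣q∣ []            q = refl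
∣p++q∣≡∣p∣+∣q∣ (inside  ∷ p) q = cong suc (∣p++q∣≡∣p∣+∣q∣ p q)
∣p++q∣≡∣p∣+∣q∣ (outside ∷ p) q = ∣p++q∣≡∣p∣+∣q∣ p q

module Subdivision {n : ℕ} (T : Graph n) (u v : Fin n) (k : ℕ) where

  Vertex : Set
  Vertex = Fin n ⊎ Fin k

  -- The (private) adjacency underlying subdivide T u v k, on old vertices ⊎ path vertices.
  infix 4 _~_
  _~_ : Vertex → Vertex → Set
  inj₁ x ~ inj₁ y = Adj T x y × ¬ (x ≡ u × y ≡ v) × ¬ (x ≡ v × y ≡ u)
  inj₁ x ~ inj₂ j = (x ≡ u × toℕ j ≡ 0) ⊎ (x ≡ v × suc (toℕ j) ≡ k)
  inj₂ i ~ inj₁ y = (y ≡ u × toℕ i ≡ 0) ⊎ (y ≡ v × suc (toℕ i) ≡ k)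
  inj₂ i ~ inj₂ j = suc (toℕ i) ≡ toℕ j ⊎ suc (toℕ j) ≡ toℕ i

  Sub : Graph (n + k)
  Sub = subdivide T u v k

  Adj⇒~ : ∀ {x y} → Adj Sub x y → splitAt n x ~ splitAt n y
  Adj⇒~ {x} {y} xy with splitAt n x | splitAt n y
  ... | inj₁ _ | inj₁ _ = xy
  ... | inj₁ _ | inj₂ _ = xy
  ... | inj₂ _ | inj₁ _ = xy
  ... | inj₂ _ | inj₂ _ = xy

  ~⇒Adj : ∀ {x y} → splitAt n x ~ splitAt n y → Adj Sub x y
  ~⇒Adj {x} {y} xy with splitAt n x | splitAt n y
  ... | inj₁ _ | inj₁ _ = xy
  ... | inj₁ _ | inj₂ _ = xy
  ... | inj₂ _ | inj₁ _ = xy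
  ... | inj₂ _ | inj₂ _ = xy

  join-~⇒Adj : ∀ {a b} → a ~ b → Adj Sub (join n k a) (join n k b)
  join-~⇒Adj {a} {b} ab = ~⇒Adj (subst₂ _~_ (sym (splitAt-join n k a)) (sym (splitAt-join n k b)) ab)

  ~-irrefl : ∀ {a} → ¬ a ~ a
  ~-irrefl = irrefl Sub ∘ join-~⇒Adj

  ~-sym : Symmetric _~_
  ~-sym {a} {b} ab =
    subst₂ _~_ (splitAt-join n k b) (splitAt-join n k a) (Adj⇒~ (Graph.sym Sub (join-~⇒Adj ab)))

  splitAt-injective : Injective _≡_ _≡_ (splitAt n {k})
  splitAt-injective {x} {y} eq =
    trans (sym (join-splitAt n k x)) (trans (cong (join n k) eq) (join-splitAt n k y))

  join-injective : Injective _≡_ _≡_ (join n k)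
  join-injective {a} {b} eq =
    trans (sym (splitAt-join n k a)) (trans (cong (splitAt n) eq) (splitAt-join n k b))

  In : Subset n → Subset k → Pred Vertex 0ℓ
  In S P = [ _∈ S , _∈ P ]′

  ∈-++⇒In : ∀ {S P x} → x ∈ S ++ P → In S P (splitAt n x)
  ∈-++⇒In {S} {P} {x} x∈ with splitAt n x | lookup-splitAt n S P x
  ... | inj₁ a | eq = lookup⇒[]= a S (trans (sym eq) ([]=⇒lookup x∈))
  ... | inj₂ j | eq = lookup⇒[]= j P (trans (sym eq) ([]=⇒lookup x∈))

  In⇒∈-++ : ∀ {S P x} → In S P (splitAt n x) → x ∈ S ++ P
  In⇒∈-++ {S} {P} {x} x∈ with splitAt n x | lookup-splitAt n S P x
  ... | inj₁ a | eq = lookup⇒[]= x (S ++ P) (trans eq ([]=⇒lookup x∈))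
  ... | inj₂ j | eq = lookup⇒[]= x (S ++ P) (trans eq ([]=⇒lookup x∈))

  dissociated⇒dissociationSet : ∀ {S P} → Dissociated _~_ (In S P) → IsDissociationSet Sub (S ++ P)
  dissociated⇒dissociationSet =
    dissociated-pullback (splitAt n) splitAt-injective (λ _ _ → Adj⇒~) ∈-++⇒In

  dissociationSet⇒dissociated : ∀ {S P} → IsDissociationSet Sub (S ++ P) → Dissociated _~_ (In S P)
  dissociationSet⇒dissociated {S} {P} = dissociated-pullback (join n k) join-injective
    (λ _ _ → join-~⇒Adj)
    (λ {a} a∈ → In⇒∈-++ (subst (In S P) (sym (splitAt-join n k a)) a∈))

  Old : Subset n → Pred Vertex 0ℓ
  Old S = [ _∈ S , (λ _ → ⊥) ]′

  old-dissociated : ∀ {S} → IsDissociationSet T S → Dissociated _~_ (Old S)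
  old-dissociated D {inj₁ _} {inj₁ _} {inj₁ _} x∈ y∈ z∈ (xy , _) (xz , _) = cong inj₁ (D x∈ y∈ z∈ xy xz)
  old-dissociated D {inj₁ _} {inj₁ _} {inj₂ _} _ _ ()
  old-dissociated D {inj₁ _} {inj₂ _} _ ()
  old-dissociated D {inj₂ _} ()

  dissociationSet-restrict : ∀ {S P S₀} → Dissociated _~_ (In S P) → (_∈ S₀) ⊆ (_∈ S) →
    ¬ (u ∈ S₀ × v ∈ S₀) → IsDissociationSet T S₀
  dissociationSet-restrict {S₀ = S₀} D S₀⊆S not-both =
    dissociated-pullback {_≈_ = _~_} inj₁ inj₁-injective edge S₀⊆S D
    where
    edge : ∀ {x y} → x ∈ S₀ → y ∈ S₀ → Adj T x y → inj₁ x ~ inj₁ y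
    edge x∈ y∈ xy =
      xy , (λ { (refl , refl) → not-both (x∈ , y∈) }) , (λ { (refl , refl) → not-both (y∈ , x∈) })

  Extension : Subset n → ℕ → Set
  Extension S l = Σ (Subset k) λ P → ∣ P ∣ ≡ l × Dissociated _~_ (In S P)

  Reduction : Subset n → Subset k → ℕ → Set
  Reduction S P m = Σ (Subset n) λ S₀ → IsDissociationSet T S₀ × ∣ S ∣ + ∣ P ∣ ≤ ∣ S₀ ∣ + m

  diss-lower : ∀ {d dₖ l} → IsDiss T d → IsDiss Sub dₖ →
    (∀ S → IsDissociationSet T S → Extension S l) → d + l ≤ dₖ
  diss-lower ((S , D , refl) , _) (_ , maximal) extend with extend S D
  ... | P , refl , DP =
    subst (_≤ _) (∣p++q∣≡∣p∣+∣q∣ S P) (maximal (S ++ P) (dissociated⇒dissociationSet DP))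

  diss-upper : ∀ {d dₖ m} → IsDiss T d → IsDiss Sub dₖ →
    (∀ S P → Dissociated _~_ (In S P) → Reduction S P m) → dₖ ≤ d + m
  diss-upper {d} {m = m} (_ , maximal) ((X , D , refl) , _) reduce with Vec.splitAt n X
  ... | S , P , refl with reduce S P (dissociationSet⇒dissociated D)
  ...   | S₀ , D₀ , ≤S₀ = begin
    ∣ S ++ P ∣      ≡⟨ ∣p++q∣≡∣p∣+∣q∣ S P ⟩
    ∣ S ∣ + ∣ P ∣   ≤⟨ ≤S₀ ⟩
    ∣ S₀ ∣ + m      ≤⟨ +-monoˡ-≤ m (maximal S₀ D₀) ⟩
    d + m           ∎
    where open ≤-Reasoning

  keep-old : ∀ {S P m} → Dissociated _~_ (In S P) → ¬ (u ∈ S × v ∈ S) → ∣ P ∣ ≤ m → Reduction S P m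
  keep-old {S} D not-both ∣P∣≤m = S , dissociationSet-restrict D id not-both , +-monoʳ-≤ ∣ S ∣ ∣P∣≤m

  drop-u : ∀ {S P m} → Dissociated _~_ (In S P) → suc ∣ P ∣ ≤ m → Reduction S P m
  drop-u {S} {P} {m} D ∣P∣<m =
    S⁻ , dissociationSet-restrict D (p─q⊆p S ⁅ u ⁆) (λ (u∈ , _) → x∈p-y⇒x≢y u∈ refl) , (begin
      ∣ S ∣ + ∣ P ∣          ≤⟨ +-monoˡ-≤ ∣ P ∣ (∣p∣≤∣p-x∣+1 S u) ⟩
      ∣ S⁻ ∣ + 1 + ∣ P ∣     ≡⟨ +-assoc (∣ S⁻ ∣) 1 (∣ P ∣) ⟩
      ∣ S⁻ ∣ + suc ∣ P ∣     ≤⟨ +-monoʳ-≤ ∣ S⁻ ∣ ∣P∣<m ⟩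
      ∣ S⁻ ∣ + m             ∎)
    where
    open ≤-Reasoning
    S⁻ : Subset n
    S⁻ = S - u

pattern p₀ = inj₂ zero
pattern p₁ = inj₂ (suc zero)
pattern p₂ = inj₂ (suc (suc zero))

module _ {n : ℕ} {T : Graph n} {u v : Fin n} (uv : Adj T u v) where

  u≢v : u ≢ v
  u≢v refl = irrefl T uv

  u-matched-separated : ∀ {k S S′} → let open Subdivision T u v (2 + k) in
    IsDissociationSet T S → u ∈ S → v ∈ S → (_∈ S′) ⊆ (_∈ S) → u ∉ S′ →
    Separated _~_ (Old S′) (｛ inj₁ u ｝ ∪ ｛ p₀ ｝)
  u-matched-separated D u∈ v∈ S′⊆S u∉ {inj₁ x} x∈ (inj₁ refl) (xu , _ , not-vu) =
    not-vu (D u∈ (S′⊆S x∈) v∈ (Graph.sym T xu) uv , refl)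
  u-matched-separated D u∈ v∈ S′⊆S u∉ {inj₁ x} x∈ (inj₂ refl) (inj₁ (refl , _)) = u∉ x∈
  u-matched-separated D u∈ v∈ S′⊆S u∉ {inj₁ x} x∈ (inj₂ refl) (inj₂ (_ , ()))

  both-matched⇒dissociationSet : ∀ {k S P i j} → let open Subdivision T u v k in
    Dissociated _~_ (In S P) → u ∈ S → v ∈ S →
    i ∈ P → inj₁ u ~ inj₂ i → j ∈ P → inj₁ v ~ inj₂ j → IsDissociationSet T S
  both-matched⇒dissociationSet {k} {S} {i = i} {j} D u∈ v∈ i∈ ui j∈ vj = dissociation
    where
    open Subdivision T u v k
    -- A neighbour y ≠ v of u in S would be a second neighbour of u besides p_i.
    only-v : ∀ {y} → y ∈ S → Adj T u y → y ≡ v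
    only-v {y} y∈ uy = decidable-stable (y ≟ v) λ y≢v →
      contradiction (D {c = inj₂ i} u∈ y∈ i∈ (uy , (y≢v ∘ proj₂) , (u≢v ∘ proj₁)) ui) λ ()
    only-u : ∀ {y} → y ∈ S → Adj T v y → y ≡ u
    only-u {y} y∈ vy = decidable-stable (y ≟ u) λ y≢u →
      contradiction (D {c = inj₂ j} v∈ y∈ j∈ (vy , (u≢v ∘ sym ∘ proj₁) , (y≢u ∘ proj₂)) vj) λ ()
    dissociation : IsDissociationSet T S
    dissociation {x} x∈ y∈ z∈ xy xz with x ≟ u | x ≟ v
    ... | yes refl | _        = trans (only-v y∈ xy) (sym (only-v z∈ xz))
    ... | no _     | yes refl = trans (only-u y∈ xy) (sym (only-u z∈ xz))
    ... | no x≢u   | no x≢v   = inj₁-injective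
      (D x∈ y∈ z∈ (xy , (x≢u ∘ proj₁) , (x≢v ∘ proj₁)) (xz , (x≢u ∘ proj₁) , (x≢v ∘ proj₁)))

  module _ where
    open Subdivision T u v 1

    extend₁ : ∀ S → IsDissociationSet T S → Extension S 0
    extend₁ S D = (outside ∷ []) , refl , dissociated-⊆′ _~_ cover (old-dissociated D)
      where
      cover : In S (outside ∷ []) ⊆′ Old S
      cover (inj₁ _) x∈ = x∈
      cover p₀ ()

    reduce₁ : ∀ S P → Dissociated _~_ (In S P) → Reduction S P 1
    reduce₁ S P D with (u ∈? S) ×-dec (v ∈? S)
    ... | no not-both = keep-old D not-both (∣p∣≤n P)
    reduce₁ S (outside ∷ []) D | yes _ = drop-u D ≤-refl
    reduce₁ S (inside ∷ []) D | yes (u∈ , v∈) =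
      contradiction (inj₁-injective (D {p₀} here u∈ v∈ (inj₁ (refl , refl)) (inj₂ (refl , refl)))) u≢v

    diss-subdivide₁ : ∀ {d d₁} → IsDiss T d → IsDiss Sub d₁ → d ≤ d₁ × d₁ ≤ d + 1
    diss-subdivide₁ {d} hd h₁ =
      subst (_≤ _) (+-identityʳ d) (diss-lower hd h₁ extend₁) , diss-upper hd h₁ reduce₁

  module _ where
    open Subdivision T u v 2

    extend₂-avoiding-v : ∀ {S} → IsDissociationSet T S → v ∉ S → Extension S 1
    extend₂-avoiding-v {S} D v∉ = (outside ∷ inside ∷ []) , refl ,
      dissociated-⊆′ _~_ cover (dissociated-∪ _~_ ~-sym (old-dissociated D) (dissociated-｛｝ _~_ p₁) sep)
      where
      cover : In S (outside ∷ inside ∷ []) ⊆′ Old S ∪ ｛ p₁ ｝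
      cover (inj₁ _) x∈ = inj₁ x∈
      cover p₀ ()
      cover p₁ _ = inj₂ refl
      sep : Separated _~_ (Old S) ｛ p₁ ｝
      sep {inj₁ _} x∈ refl (inj₂ (refl , _)) = v∉ x∈

    extend₂-avoiding-u : ∀ {S} → IsDissociationSet T S → u ∉ S → Extension S 1
    extend₂-avoiding-u {S} D u∉ = (inside ∷ outside ∷ []) , refl ,
      dissociated-⊆′ _~_ cover (dissociated-∪ _~_ ~-sym (old-dissociated D) (dissociated-｛｝ _~_ p₀) sep)
      where
      cover : In S (inside ∷ outside ∷ []) ⊆′ Old S ∪ ｛ p₀ ｝
      cover (inj₁ _) x∈ = inj₁ x∈
      cover p₀ _ = inj₂ refl
      cover p₁ (there ())
      sep : Separated _~_ (Old S) ｛ p₀ ｝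
      sep {inj₁ _} x∈ refl (inj₁ (refl , _)) = u∉ x∈

    extend₂-matching-u : ∀ {S} → IsDissociationSet T S → u ∈ S → v ∈ S → Extension S 1
    extend₂-matching-u {S} D u∈ v∈ = (inside ∷ outside ∷ []) , refl ,
      dissociated-⊆′ _~_ cover (dissociated-∪ _~_ ~-sym
        (old-dissociated (dissociated-⊆′ (Adj T) (λ _ → p─q⊆p S ⁅ u ⁆) D))
        (dissociated-pair _~_ ~-irrefl (inj₁ u) p₀)
        (u-matched-separated D u∈ v∈ (p─q⊆p S ⁅ u ⁆) (λ u∈S-u → x∈p-y⇒x≢y u∈S-u refl)))
      where
      cover : In S (inside ∷ outside ∷ []) ⊆′ Old (S - u) ∪ (｛ inj₁ u ｝ ∪ ｛ p₀ ｝)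
      cover (inj₁ x) x∈ with x ≟ u
      ... | yes refl = inj₂ (inj₁ refl)
      ... | no x≢u   = inj₁ (x∈p∧x≢y⇒x∈p-y x∈ x≢u)
      cover p₀ _ = inj₂ (inj₂ refl)
      cover p₁ (there ())

    extend₂ : ∀ S → IsDissociationSet T S → Extension S 1
    extend₂ S D with v ∈? S | u ∈? S
    ... | no v∉  | _      = extend₂-avoiding-v D v∉
    ... | yes _  | no u∉  = extend₂-avoiding-u D u∉
    ... | yes v∈ | yes u∈ = extend₂-matching-u D u∈ v∈

    reduce₂ : ∀ S P → Dissociated _~_ (In S P) → Reduction S P 2
    reduce₂ S P D with (u ∈? S) ×-dec (v ∈? S)
    ... | no not-both = keep-old D not-both (∣p∣≤n P)
    reduce₂ S (inside ∷ inside ∷ []) D | yes (u∈ , _) =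
      contradiction (D {p₀} {inj₁ u} {p₁} here u∈ (there here) (inj₁ (refl , refl)) (inj₁ refl)) λ ()
    reduce₂ S (inside  ∷ outside ∷ []) D | yes _ = drop-u D ≤-refl
    reduce₂ S (outside ∷ inside  ∷ []) D | yes _ = drop-u D ≤-refl
    reduce₂ S (outside ∷ outside ∷ []) D | yes _ = drop-u D (s≤s z≤n)

    diss-subdivide₂ : ∀ {d d₂} → IsDiss T d → IsDiss Sub d₂ → d + 1 ≤ d₂ × d₂ ≤ d + 2
    diss-subdivide₂ hd h₂ = diss-lower hd h₂ extend₂ , diss-upper hd h₂ reduce₂

  module _ where
    open Subdivision T u v 3

    extend₃-avoiding-v : ∀ {S} → IsDissociationSet T S → v ∉ S → Extension S 2
    extend₃-avoiding-v {S} D v∉ = (outside ∷ inside ∷ inside ∷ []) , refl ,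
      dissociated-⊆′ _~_ cover
        (dissociated-∪ _~_ ~-sym (old-dissociated D) (dissociated-pair _~_ ~-irrefl p₁ p₂) sep)
      where
      cover : In S (outside ∷ inside ∷ inside ∷ []) ⊆′ Old S ∪ (｛ p₁ ｝ ∪ ｛ p₂ ｝)
      cover (inj₁ _) x∈ = inj₁ x∈
      cover p₀ ()
      cover p₁ _ = inj₂ (inj₁ refl)
      cover p₂ _ = inj₂ (inj₂ refl)
      sep : Separated _~_ (Old S) (｛ p₁ ｝ ∪ ｛ p₂ ｝)
      sep {inj₁ _} x∈ (inj₁ refl) (inj₁ (_ , ()))
      sep {inj₁ _} x∈ (inj₁ refl) (inj₂ (_ , ()))
      sep {inj₁ _} x∈ (inj₂ refl) (inj₂ (refl , _)) = v∉ x∈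

    extend₃-avoiding-u : ∀ {S} → IsDissociationSet T S → u ∉ S → Extension S 2
    extend₃-avoiding-u {S} D u∉ = (inside ∷ inside ∷ outside ∷ []) , refl ,
      dissociated-⊆′ _~_ cover
        (dissociated-∪ _~_ ~-sym (old-dissociated D) (dissociated-pair _~_ ~-irrefl p₀ p₁) sep)
      where
      cover : In S (inside ∷ inside ∷ outside ∷ []) ⊆′ Old S ∪ (｛ p₀ ｝ ∪ ｛ p₁ ｝)
      cover (inj₁ _) x∈ = inj₁ x∈
      cover p₀ _ = inj₂ (inj₁ refl)
      cover p₁ _ = inj₂ (inj₂ refl)
      cover p₂ (there (there ()))
      sep : Separated _~_ (Old S) (｛ p₀ ｝ ∪ ｛ p₁ ｝)
      sep {inj₁ _} x∈ (inj₁ refl) (inj₁ (refl , _)) = u∉ x∈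
      sep {inj₁ _} x∈ (inj₂ refl) (inj₁ (_ , ()))
      sep {inj₁ _} x∈ (inj₂ refl) (inj₂ (_ , ()))

    extend₃-matching-u-v : ∀ {S} → IsDissociationSet T S → u ∈ S → v ∈ S → Extension S 2
    extend₃-matching-u-v {S} D u∈ v∈ = (inside ∷ outside ∷ inside ∷ []) , refl ,
      dissociated-⊆′ _~_ cover (dissociated-∪ _~_ ~-sym
        (old-dissociated (dissociated-⊆′ (Adj T) (λ _ → S-u-v⊆S) D))
        (dissociated-∪ _~_ ~-sym (dissociated-pair _~_ ~-irrefl (inj₁ u) p₀)
                                 (dissociated-pair _~_ ~-irrefl (inj₁ v) p₂) sepᵘᵛ)
        λ { x∈ (inj₁ b∈) → u-matched-separated D u∈ v∈ S-u-v⊆S u∉S-u-v x∈ b∈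
          ; x∈ (inj₂ b∈) → sepᵛ x∈ b∈ })
      where
      S-u-v⊆S : (_∈ S - u - v) ⊆ (_∈ S)
      S-u-v⊆S = p─q⊆p S ⁅ u ⁆ ∘ p─q⊆p (S - u) ⁅ v ⁆
      u∉S-u-v : u ∉ S - u - v
      u∉S-u-v u∈S-u-v = x∈p-y⇒x≢y (p─q⊆p (S - u) ⁅ v ⁆ u∈S-u-v) refl
      cover : In S (inside ∷ outside ∷ inside ∷ []) ⊆′
              Old (S - u - v) ∪ ((｛ inj₁ u ｝ ∪ ｛ p₀ ｝) ∪ (｛ inj₁ v ｝ ∪ ｛ p₂ ｝))
      cover (inj₁ x) x∈ with x ≟ u | x ≟ v
      ... | yes refl | _        = inj₂ (inj₁ (inj₁ refl))
      ... | no _     | yes refl = inj₂ (inj₂ (inj₁ refl))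
      ... | no x≢u   | no x≢v   = inj₁ (x∈p∧x≢y⇒x∈p-y (x∈p∧x≢y⇒x∈p-y x∈ x≢u) x≢v)
      cover p₀ _ = inj₂ (inj₁ (inj₂ refl))
      cover p₁ (there ())
      cover p₂ _ = inj₂ (inj₂ (inj₂ refl))
      sepᵛ : Separated _~_ (Old (S - u - v)) (｛ inj₁ v ｝ ∪ ｛ p₂ ｝)
      sepᵛ {inj₁ x} x∈ (inj₁ refl) (xv , not-uv , _) =
        not-uv (D v∈ (S-u-v⊆S x∈) u∈ (Graph.sym T xv) (Graph.sym T uv) , refl)
      sepᵛ {inj₁ x} x∈ (inj₂ refl) (inj₂ (refl , _)) = x∈p-y⇒x≢y x∈ refl
      sepᵘᵛ : Separated _~_ (｛ inj₁ u ｝ ∪ ｛ p₀ ｝) (｛ inj₁ v ｝ ∪ ｛ p₂ ｝)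
      sepᵘᵛ (inj₁ refl) (inj₁ refl) (_ , not-uv , _) = not-uv (refl , refl)
      sepᵘᵛ (inj₁ refl) (inj₂ refl) (inj₂ (u≡v , _)) = u≢v u≡v
      sepᵘᵛ (inj₂ refl) (inj₁ refl) (inj₁ (v≡u , _)) = u≢v (sym v≡u)
      sepᵘᵛ (inj₂ refl) (inj₂ refl) (inj₁ ())
      sepᵘᵛ (inj₂ refl) (inj₂ refl) (inj₂ ())

    extend₃ : ∀ S → IsDissociationSet T S → Extension S 2
    extend₃ S D with v ∈? S | u ∈? S
    ... | no v∉  | _      = extend₃-avoiding-v D v∉
    ... | yes _  | no u∉  = extend₃-avoiding-u D u∉
    ... | yes v∈ | yes u∈ = extend₃-matching-u-v D u∈ v∈

    reduce₃ : ∀ S P → Dissociated _~_ (In S P) → Reduction S P 2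
    reduce₃ S P D with (u ∈? S) ×-dec (v ∈? S)
    ... | no not-both = keep-old D not-both ∣P∣≤2
      where
      P≢⊤ : P ≢ ⊤
      P≢⊤ refl =
        contradiction (D {p₁} {p₀} {p₂} (there here) here (there (there here)) (inj₂ refl) (inj₁ refl)) λ ()
      ∣P∣≤2 : ∣ P ∣ ≤ 2
      ∣P∣≤2 = s≤s⁻¹ (≤∧≢⇒< (∣p∣≤n P) (P≢⊤ ∘ ∣p∣≡n⇒p≡⊤))
    reduce₃ S (inside ∷ inside ∷ _ ∷ []) D | yes (u∈ , _) =
      contradiction (D {p₀} {inj₁ u} {p₁} here u∈ (there here) (inj₁ (refl , refl)) (inj₁ refl)) λ ()
    reduce₃ S (_ ∷ inside ∷ inside ∷ []) D | yes (_ , v∈) =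
      contradiction
        (D {p₂} {inj₁ v} {p₁} (there (there here)) v∈ (there here) (inj₂ (refl , refl)) (inj₂ refl)) λ ()
    reduce₃ S (inside ∷ outside ∷ inside ∷ []) D | yes (u∈ , v∈) =
      S , both-matched⇒dissociationSet D u∈ v∈ here (inj₁ (refl , refl)) (there (there here)) (inj₂ (refl , refl))
        , ≤-refl
    reduce₃ S (inside  ∷ outside ∷ outside ∷ []) D | yes _ = drop-u D ≤-refl
    reduce₃ S (outside ∷ inside  ∷ outside ∷ []) D | yes _ = drop-u D ≤-refl
    reduce₃ S (outside ∷ outside ∷ inside  ∷ []) D | yes _ = drop-u D ≤-refl
    reduce₃ S (outside ∷ outside ∷ outside ∷ []) D | yes _ = drop-u D (s≤s z≤n)

    diss-subdivide₃ : ∀ {d d₃} → IsDiss T d → IsDiss Sub d₃ → d + 2 ≤ d₃ × d₃ ≤ d + 2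
    diss-subdivide₃ hd h₃ = diss-lower hd h₃ extend₃ , diss-upper hd h₃ reduce₃

m≤n≤m+1⇒n≡m⊎n≡m+1 : ∀ {m n} → m ≤ n → n ≤ m + 1 → n ≡ m ⊎ n ≡ m + 1
m≤n≤m+1⇒n≡m⊎n≡m+1 {m} {n} m≤n n≤m+1 with m≤n⇒m<n∨m≡n m≤n
... | inj₂ m≡n = inj₁ (sym m≡n)
... | inj₁ m<n = inj₂ (≤-antisym n≤m+1 (subst (_≤ n) (+-comm 1 m) m<n))

lemma2p10 : ∀ {n} (T : Graph n) → IsTree T → (u v : Fin n) → Adj T u v →
    ∀ d d₁ d₂ d₃ → IsDiss T d →
    IsDiss (subdivide T u v 1) d₁ →
    IsDiss (subdivide T u v 2) d₂ →
    IsDiss (subdivide T u v 3) d₃ →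
    (d₁ ≡ d ⊎ d₁ ≡ d + 1)
      × (d₂ ≡ d + 1 ⊎ d₂ ≡ d + 2)
      × d₃ ≡ d + 2
lemma2p10 T _ u v uv d d₁ d₂ d₃ hd h₁ h₂ h₃ =
  let d≤d₁   , d₁≤d+1 = diss-subdivide₁ uv hd h₁
      d+1≤d₂ , d₂≤d+2 = diss-subdivide₂ uv hd h₂
      d+2≤d₃ , d₃≤d+2 = diss-subdivide₃ uv hd h₃
  in  m≤n≤m+1⇒n≡m⊎n≡m+1 d≤d₁ d₁≤d+1
    , map₂ (λ d₂≡d+1+1 → trans d₂≡d+1+1 (+-assoc d 1 1))
        (m≤n≤m+1⇒n≡m⊎n≡m+1 d+1≤d₂ (subst (d₂ ≤_) (sym (+-assoc d 1 1)) d₂≤d+2))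
    , ≤-antisym d₃≤d+2 d+2≤d₃
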